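{- Let $\mathbf{C}$ be a quasi-topos and $\mathcal{M}$ its class of regular monomorphisms. Let $A\xrightarrow{f}B\xrightarrow{b}D$ with $b\in\mathcal{M}$. (i) (Universal property) Suppose $A\xrightarrow{n}C$ with $n\in\mathcal{M}$, and $B\xrightarrow{m}E\xleftarrow{q}C$ form a pushout of $B\xleftarrow{f}A\xrightarrow{n}C$, and suppose $m=m'\circ b$ for some $m':D\to E$ with $m'\in\mathcal{M}$. Then there exist an element $(a:A\to P,\ d:P\to D)$ of $\mathrm{mPOC}(f,b)$ and $p:P\to C$ in $\mathcal{M}$ with $p\circ a=n$ and $q\circ p=m'\circ d$ such that the square $P\xrightarrow{p}C\xrightarrow{q}E$, $P\xrightarrow{d}D\xrightarrow{m'}E$ is a pushout. Moreover, for any other element $(a',d')$ of $\mathrm{mPOC}(f,b)$ with some $p'\in\mathcal{M}$ having the same property, there is an isomorphism $\delta$ with $\delta\circ a=a'$ and $d'\circ\delta=d$. (ii) (Computation) Let $A\xrightarrow{n}F\xrightarrow{g}D$ be the final pullback complement of $(f,b)$. Then the elements of $\mathrm{mPOC}(f,b)$ are (up to isomorphism) exactly obtained as follows: for a pair $(a:A\to P,\ p:P\to F)$ with $a\in\mathcal{M}$ and $p\circ a=n$, form the pushout $B\to D'\leftarrow P$ of $B\xleftarrow{f}A\xrightarrow{a}P$; if the morphism $e:D'\to D$ induced by $b$ and $g\circ p$ is an isomorphism, then $(a,\ g\circ p)$ is an element of $\mathrm{mPOC}(f,b)$; and every element of $\mathrm{mPOC}(f,b)$ arises in this way.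
   Context: A quasi-topos is a category with finite limits and colimits, locally Cartesian closed, with a regular-subobject classifier; $\mathcal{M}$ denotes the regular monos. For $A\xrightarrow{f}B\xrightarrow{b}D$ with $b\in\mathcal{M}$, the $\mathcal{M}$-multi-pushout complement $\mathrm{mPOC}(f,b)$ is the set of pairs $(A\xrightarrow{a}P,P\xrightarrow{d}D)$ with $a\in\mathcal{M}$ such that $B\xrightarrow{b}D\xleftarrow{d}P$ is a pushout of $B\xleftarrow{f}A\xrightarrow{a}P$. A final pullback complement (FPC) of $A\xrightarrow{f}B\xrightarrow{b}D$ is a pair $A\xrightarrow{n}F\xrightarrow{g}D$ with $b\circ f=g\circ n$ a pullback square such that for every pullback square $b\circ f\circ x=d\circ y$ (with $x:X\to A$, $y:X\to Y$, $d:Y\to D$) there is a unique $w:Y\to F$ with $g\circ w=d$, $w\circ y=n\circ x$; in a quasi-topos FPCs of such pairs with $b\in\mathcal{M}$ exist. -}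

module Defs where

open import Level using (Level; _⊔_; suc)
open import Data.Product using (Σ; _×_; _,_; proj₁)
open import Relation.Binary using (Rel; IsEquivalence)

record Category (o ℓ e : Level) : Set (suc (o ⊔ ℓ ⊔ e)) where
  infixr 9 _∘_
  infix  4 _≈_
  infixr 2 _⇒_
  field
    Obj   : Set o
    _⇒_   : Obj → Obj → Set ℓ
    _≈_   : ∀ {A B} → Rel (A ⇒ B) e
    id    : ∀ {A} → A ⇒ A
    _∘_   : ∀ {A B C} → B ⇒ C → A ⇒ B → A ⇒ C
    equiv : ∀ {A B} → IsEquivalence (_≈_ {A} {B})
    ∘-resp-≈ : ∀ {A B C} {f h : B ⇒ C} {g i : A ⇒ B} → f ≈ h → g ≈ i → f ∘ g ≈ h ∘ i
    assoc : ∀ {A B C D} {f : A ⇒ B} {g : B ⇒ C} {h : C ⇒ D} → (h ∘ g) ∘ f ≈ h ∘ (g ∘ f)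
    identityˡ : ∀ {A B} {f : A ⇒ B} → id ∘ f ≈ f
    identityʳ : ∀ {A B} {f : A ⇒ B} → f ∘ id ≈ f

module Notions {o ℓ e : Level} (𝒞 : Category o ℓ e) where
  open Category 𝒞

  IsIso : ∀ {A B} → A ⇒ B → Set (ℓ ⊔ e)
  IsIso {A} {B} f = Σ (B ⇒ A) λ g → (g ∘ f ≈ id) × (f ∘ g ≈ id)

  IsEqualizer : ∀ {X Y Z} (h k : Y ⇒ Z) (m : X ⇒ Y) → Set (o ⊔ ℓ ⊔ e)
  IsEqualizer {X} {Y} h k m =
    (h ∘ m ≈ k ∘ m) ×
    (∀ {W} (x : W ⇒ Y) → h ∘ x ≈ k ∘ x → Σ (W ⇒ X) λ u → m ∘ u ≈ x) ×
    (∀ {W} (u v : W ⇒ X) → m ∘ u ≈ m ∘ v → u ≈ v)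

  RegularMono : ∀ {X Y} → X ⇒ Y → Set (o ⊔ ℓ ⊔ e)
  RegularMono {X} {Y} m = Σ Obj λ Z → Σ (Y ⇒ Z) λ h → Σ (Y ⇒ Z) λ k → IsEqualizer h k m

  IsPullback : ∀ {A B C P} (f : A ⇒ C) (g : B ⇒ C) (π₁ : P ⇒ A) (π₂ : P ⇒ B) → Set (o ⊔ ℓ ⊔ e)
  IsPullback {A} {B} {C} {P} f g π₁ π₂ =
    (f ∘ π₁ ≈ g ∘ π₂) ×
    (∀ {W} (x : W ⇒ A) (y : W ⇒ B) → f ∘ x ≈ g ∘ y → Σ (W ⇒ P) λ u → (π₁ ∘ u ≈ x) × (π₂ ∘ u ≈ y)) ×
    (∀ {W} (u v : W ⇒ P) → π₁ ∘ u ≈ π₁ ∘ v → π₂ ∘ u ≈ π₂ ∘ v → u ≈ v)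

  IsPushout : ∀ {A B C Q} (f : C ⇒ A) (g : C ⇒ B) (i₁ : A ⇒ Q) (i₂ : B ⇒ Q) → Set (o ⊔ ℓ ⊔ e)
  IsPushout {A} {B} {C} {Q} f g i₁ i₂ =
    (i₁ ∘ f ≈ i₂ ∘ g) ×
    (∀ {W} (x : A ⇒ W) (y : B ⇒ W) → x ∘ f ≈ y ∘ g → Σ (Q ⇒ W) λ u → (u ∘ i₁ ≈ x) × (u ∘ i₂ ≈ y)) ×
    (∀ {W} (u v : Q ⇒ W) → u ∘ i₁ ≈ v ∘ i₁ → u ∘ i₂ ≈ v ∘ i₂ → u ≈ v)

  IsTerminal : Obj → Set (o ⊔ ℓ ⊔ e)
  IsTerminal T = ∀ X → Σ (X ⇒ T) λ t → ∀ (u : X ⇒ T) → u ≈ t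

  IsInitial : Obj → Set (o ⊔ ℓ ⊔ e)
  IsInitial I = ∀ X → Σ (I ⇒ X) λ t → ∀ (u : I ⇒ X) → u ≈ t

  HasFiniteLimits : Set (o ⊔ ℓ ⊔ e)
  HasFiniteLimits =
    Σ Obj IsTerminal ×
    (∀ {A B C} (f : A ⇒ C) (g : B ⇒ C) → Σ Obj λ P → Σ (P ⇒ A) λ π₁ → Σ (P ⇒ B) λ π₂ → IsPullback f g π₁ π₂)

  HasFiniteColimits : Set (o ⊔ ℓ ⊔ e)
  HasFiniteColimits =
    Σ Obj IsInitial ×
    (∀ {A B C} (f : C ⇒ A) (g : C ⇒ B) → Σ Obj λ Q → Σ (A ⇒ Q) λ i₁ → Σ (B ⇒ Q) λ i₂ → IsPushout f g i₁ i₂)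

  -- Exponential q^p in the slice C/X of objects p : Y ⇒ X, q : Z ⇒ X.
  -- The slice product of (r : E ⇒ X) and p is the pullback of r and p.
  -- ev : E ×_X Y ⇒ Z over X, and every h : W ×_X Y ⇒ Z over X has a
  -- unique transpose k : W ⇒ E over X with ev ∘ (k ×_X Y) ≈ h.
  SliceExponential : ∀ {X Y Z} (p : Y ⇒ X) (q : Z ⇒ X) → Set (o ⊔ ℓ ⊔ e)
  SliceExponential {X} {Y} {Z} p q =
    Σ Obj λ E → Σ (E ⇒ X) λ r →
    Σ Obj λ EY → Σ (EY ⇒ E) λ e₁ → Σ (EY ⇒ Y) λ e₂ → IsPullback r p e₁ e₂ ×
    Σ (EY ⇒ Z) λ ev → (q ∘ ev ≈ p ∘ e₂) ×
    (∀ {W WY} (s : W ⇒ X) (w₁ : WY ⇒ W) (w₂ : WY ⇒ Y) → IsPullback s p w₁ w₂ →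
       (h : WY ⇒ Z) → q ∘ h ≈ p ∘ w₂ →
       Σ (W ⇒ E) λ k → (r ∘ k ≈ s) ×
         (∀ (u : WY ⇒ EY) → e₁ ∘ u ≈ k ∘ w₁ → e₂ ∘ u ≈ w₂ → ev ∘ u ≈ h) ×
         (∀ (k' : W ⇒ E) → r ∘ k' ≈ s →
            (∀ (u : WY ⇒ EY) → e₁ ∘ u ≈ k' ∘ w₁ → e₂ ∘ u ≈ w₂ → ev ∘ u ≈ h) → k' ≈ k))

  -- every slice C/X is cartesian closed (finite products in slices come from pullbacks)
  LocallyCartesianClosed : Set (o ⊔ ℓ ⊔ e)
  LocallyCartesianClosed = ∀ {X Y Z} (p : Y ⇒ X) (q : Z ⇒ X) → SliceExponential p q

  RegularSubobjectClassifier : Set (o ⊔ ℓ ⊔ e)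
  RegularSubobjectClassifier =
    Σ Obj λ T → Σ (IsTerminal T) λ isT → Σ Obj λ Ω → Σ (T ⇒ Ω) λ true →
      RegularMono true ×
      (∀ {S X} (m : S ⇒ X) → RegularMono m →
         Σ (X ⇒ Ω) λ χ → IsPullback χ true m (proj₁ (isT S)) ×
           (∀ (χ' : X ⇒ Ω) → IsPullback χ' true m (proj₁ (isT S)) → χ' ≈ χ))

  IsQuasiTopos : Set (o ⊔ ℓ ⊔ e)
  IsQuasiTopos = HasFiniteLimits × HasFiniteColimits × LocallyCartesianClosed × RegularSubobjectClassifier

  InMPOC : ∀ {A B D P} (f : A ⇒ B) (b : B ⇒ D) (a : A ⇒ P) (d : P ⇒ D) → Set (o ⊔ ℓ ⊔ e)
  InMPOC f b a d = RegularMono a × IsPushout f a b d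

  IsFPC : ∀ {A B D F} (f : A ⇒ B) (b : B ⇒ D) (n : A ⇒ F) (g : F ⇒ D) → Set (o ⊔ ℓ ⊔ e)
  IsFPC {A} {B} {D} {F} f b n g =
    IsPullback b g f n ×
    (∀ {X Y} (x : X ⇒ A) (y : X ⇒ Y) (d : Y ⇒ D) → IsPullback (b ∘ f) d x y →
       Σ (Y ⇒ F) λ w → (g ∘ w ≈ d) × (w ∘ y ≈ n ∘ x) ×
         (∀ (w' : Y ⇒ F) → g ∘ w' ≈ d → w' ∘ y ≈ n ∘ x → w' ≈ w))

-- In a quasi-topos every object B has a classifier η : B → B̃ of partial maps with regular-mono
-- domain, built from the regular-subobject classifier and an exponential over Ω.  Mapping a pushout
-- along a regular mono a into B̃ shows that the pushout square is also a pullback.  Pulling back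
-- along a mono m′ has a right adjoint Π_m′ (local cartesian closure), hence preserves pushouts.
-- (i) Pulling the given pushout back along m′ yields an element of mPOC(f, b); cancelling it from
-- the outer pushout leaves the required pushout on the right, and any competing right-hand square
-- is a pushout along a regular mono, hence a pullback of the same cospan, hence isomorphic.
-- (ii) An element (a, d) of mPOC(f, b) is a pullback square over (f, b), so the final pullback
-- complement factors it through F; and a pushout of f and a maps isomorphically onto D.
module Submission where

open import Level using (Level; _⊔_)
open import Data.Product using (Σ; _×_; _,_; proj₁; proj₂)
open import Relation.Binary using (Setoid; IsEquivalence)
import Relation.Binary.Reasoning.Setoid as SetoidReasoning
open import Defs

module HomReasoning {o ℓ e : Level} (𝒞 : Category o ℓ e) where
  open Category 𝒞

  hom-setoid : Obj → Obj → Setoid ℓ e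
  hom-setoid X Y = record { Carrier = X ⇒ Y ; _≈_ = _≈_ ; isEquivalence = equiv }

  module _ {X Y : Obj} where
    open IsEquivalence (equiv {X} {Y}) public
      using () renaming (refl to ≈-refl; sym to ≈-sym; trans to ≈-trans)
    open SetoidReasoning (hom-setoid X Y) public

  module _ {X Y Z : Obj} where
    ∘-resp-≈ˡ : {f h : Y ⇒ Z} {g : X ⇒ Y} → f ≈ h → f ∘ g ≈ h ∘ g
    ∘-resp-≈ˡ f≈h = ∘-resp-≈ f≈h ≈-refl

    ∘-resp-≈ʳ : {f : Y ⇒ Z} {g i : X ⇒ Y} → g ≈ i → f ∘ g ≈ f ∘ i
    ∘-resp-≈ʳ = ∘-resp-≈ ≈-refl

  sym-assoc : ∀ {W X Y Z} {f : W ⇒ X} {g : X ⇒ Y} {h : Y ⇒ Z} → h ∘ (g ∘ f) ≈ (h ∘ g) ∘ f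
  sym-assoc = ≈-sym assoc

  pullˡ : ∀ {W X Y Z} {f : X ⇒ Y} {g : Y ⇒ Z} {h : X ⇒ Z} {k : W ⇒ X} →
          g ∘ f ≈ h → g ∘ (f ∘ k) ≈ h ∘ k
  pullˡ gf≈h = ≈-trans sym-assoc (∘-resp-≈ˡ gf≈h)

  pullʳ : ∀ {W X Y Z} {f : W ⇒ X} {g : X ⇒ Y} {h : W ⇒ Y} {k : Y ⇒ Z} →
          g ∘ f ≈ h → (k ∘ g) ∘ f ≈ k ∘ h
  pullʳ gf≈h = ≈-trans assoc (∘-resp-≈ʳ gf≈h)

  extendˡ : ∀ {V W X Y Z} {a : X ⇒ Y} {b : W ⇒ X} {c : V ⇒ Y} {d : W ⇒ V} {f : Y ⇒ Z} →
            a ∘ b ≈ c ∘ d → (f ∘ a) ∘ b ≈ (f ∘ c) ∘ d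
  extendˡ ab≈cd = ≈-trans (pullʳ ab≈cd) sym-assoc

  extendʳ : ∀ {U V W X Y} {a : X ⇒ Y} {b : W ⇒ X} {c : V ⇒ Y} {d : W ⇒ V} {f : U ⇒ W} →
            a ∘ b ≈ c ∘ d → a ∘ (b ∘ f) ≈ c ∘ (d ∘ f)
  extendʳ ab≈cd = ≈-trans (pullˡ ab≈cd) assoc

  cancelˡ : ∀ {X Y Z} {f : X ⇒ Y} {g : Y ⇒ X} {h : Y ⇒ Z} → f ∘ g ≈ id → (h ∘ f) ∘ g ≈ h
  cancelˡ fg≈id = ≈-trans (pullʳ fg≈id) identityʳ

module Properties {o ℓ e : Level} (𝒞 : Category o ℓ e) where
  open Category 𝒞
  open Notions 𝒞
  open HomReasoning 𝒞

  Mono : ∀ {X Y} → X ⇒ Y → Set (o ⊔ ℓ ⊔ e)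
  Mono {X} m = ∀ {W} (u v : W ⇒ X) → m ∘ u ≈ m ∘ v → u ≈ v

  module Pushout {A B C Q} {f : C ⇒ A} {g : C ⇒ B} {i₁ : A ⇒ Q} {i₂ : B ⇒ Q}
                 (po : IsPushout f g i₁ i₂) where
    commute : i₁ ∘ f ≈ i₂ ∘ g
    commute = proj₁ po

    module _ {W} (x : A ⇒ W) (y : B ⇒ W) (eq : x ∘ f ≈ y ∘ g) where
      universal : Q ⇒ W
      universal = proj₁ (proj₁ (proj₂ po) x y eq)

      universal∘i₁ : universal ∘ i₁ ≈ x
      universal∘i₁ = proj₁ (proj₂ (proj₁ (proj₂ po) x y eq))

      universal∘i₂ : universal ∘ i₂ ≈ y
      universal∘i₂ = proj₂ (proj₂ (proj₁ (proj₂ po) x y eq))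

    unique : ∀ {W} (u v : Q ⇒ W) → u ∘ i₁ ≈ v ∘ i₁ → u ∘ i₂ ≈ v ∘ i₂ → u ≈ v
    unique = proj₂ (proj₂ po)

  module Pullback {A B C P} {f : A ⇒ C} {g : B ⇒ C} {π₁ : P ⇒ A} {π₂ : P ⇒ B}
                  (pb : IsPullback f g π₁ π₂) where
    commute : f ∘ π₁ ≈ g ∘ π₂
    commute = proj₁ pb

    module _ {W} (x : W ⇒ A) (y : W ⇒ B) (eq : f ∘ x ≈ g ∘ y) where
      universal : W ⇒ P
      universal = proj₁ (proj₁ (proj₂ pb) x y eq)

      π₁∘universal : π₁ ∘ universal ≈ x
      π₁∘universal = proj₁ (proj₂ (proj₁ (proj₂ pb) x y eq))

      π₂∘universal : π₂ ∘ universal ≈ y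
      π₂∘universal = proj₂ (proj₂ (proj₁ (proj₂ pb) x y eq))

    unique : ∀ {W} (u v : W ⇒ P) → π₁ ∘ u ≈ π₁ ∘ v → π₂ ∘ u ≈ π₂ ∘ v → u ≈ v
    unique = proj₂ (proj₂ pb)

  pushout-swap : ∀ {A B C Q} {f : C ⇒ A} {g : C ⇒ B} {i₁ : A ⇒ Q} {i₂ : B ⇒ Q} →
                 IsPushout f g i₁ i₂ → IsPushout g f i₂ i₁
  pushout-swap po =
    ≈-sym commute ,
    (λ x y eq → universal y x (≈-sym eq) , universal∘i₂ y x (≈-sym eq) , universal∘i₁ y x (≈-sym eq)) ,
    (λ u v eq₂ eq₁ → unique u v eq₁ eq₂)
    where open Pushout po

  pullback-swap : ∀ {A B C P} {f : A ⇒ C} {g : B ⇒ C} {π₁ : P ⇒ A} {π₂ : P ⇒ B} →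
                  IsPullback f g π₁ π₂ → IsPullback g f π₂ π₁
  pullback-swap pb =
    ≈-sym commute ,
    (λ x y eq → universal y x (≈-sym eq) , π₂∘universal y x (≈-sym eq) , π₁∘universal y x (≈-sym eq)) ,
    (λ u v eq₂ eq₁ → unique u v eq₁ eq₂)
    where open Pullback pb

  RegularMono⇒Mono : ∀ {X Y} {m : X ⇒ Y} → RegularMono m → Mono m
  RegularMono⇒Mono (_ , _ , _ , _ , _ , unique) = unique

  RegularMono-cancelˡ : ∀ {A P C} {a : A ⇒ P} {p : P ⇒ C} {n : A ⇒ C} →
                        RegularMono n → Mono p → p ∘ a ≈ n → RegularMono a
  RegularMono-cancelˡ {a = a} {p} {n} (Z , h , k , hn≈kn , factor , n-mono) p-mono pa≈n =
    Z , h ∘ p , k ∘ p , equalizes , factor′ , unique′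
    where
    equalizes : (h ∘ p) ∘ a ≈ (k ∘ p) ∘ a
    equalizes = begin
      (h ∘ p) ∘ a ≈⟨ pullʳ pa≈n ⟩
      h ∘ n       ≈⟨ hn≈kn ⟩
      k ∘ n       ≈⟨ pullʳ pa≈n ⟨
      (k ∘ p) ∘ a ∎
    factor′ : ∀ {W} (x : W ⇒ _) → (h ∘ p) ∘ x ≈ (k ∘ p) ∘ x → Σ (W ⇒ _) λ u → a ∘ u ≈ x
    factor′ x eq with factor (p ∘ x) (≈-trans sym-assoc (≈-trans eq assoc))
    ... | u , nu≈px = u , p-mono (a ∘ u) x (≈-trans (pullˡ pa≈n) nu≈px)
    unique′ : ∀ {W} (u v : W ⇒ _) → a ∘ u ≈ a ∘ v → u ≈ v
    unique′ u v au≈av = n-mono u v (begin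
      n ∘ u       ≈⟨ pullˡ pa≈n ⟨
      p ∘ (a ∘ u) ≈⟨ ∘-resp-≈ʳ au≈av ⟩
      p ∘ (a ∘ v) ≈⟨ pullˡ pa≈n ⟩
      n ∘ v       ∎)

  RegularMono-pullback : ∀ {C E D P} {q : C ⇒ E} {m : D ⇒ E} {p : P ⇒ C} {d : P ⇒ D} →
                         RegularMono m → IsPullback q m p d → RegularMono p
  RegularMono-pullback {q = q} {m} {p} {d} (Z , h , k , hm≈km , factor , m-mono) pb =
    Z , h ∘ q , k ∘ q , equalizes , factor′ , unique′
    where
    open Pullback pb
    equalizes : (h ∘ q) ∘ p ≈ (k ∘ q) ∘ p
    equalizes = begin
      (h ∘ q) ∘ p ≈⟨ extendˡ commute ⟩
      (h ∘ m) ∘ d ≈⟨ ∘-resp-≈ˡ hm≈km ⟩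
      (k ∘ m) ∘ d ≈⟨ extendˡ commute ⟨
      (k ∘ q) ∘ p ∎
    factor′ : ∀ {W} (x : W ⇒ _) → (h ∘ q) ∘ x ≈ (k ∘ q) ∘ x → Σ (W ⇒ _) λ u → p ∘ u ≈ x
    factor′ x eq with factor (q ∘ x) (≈-trans sym-assoc (≈-trans eq assoc))
    ... | z , mz≈qx = universal x z (≈-sym mz≈qx) , π₁∘universal x z (≈-sym mz≈qx)
    unique′ : ∀ {W} (u v : W ⇒ _) → p ∘ u ≈ p ∘ v → u ≈ v
    unique′ u v pu≈pv = Pullback.unique pb u v pu≈pv (m-mono (d ∘ u) (d ∘ v) (begin
      m ∘ (d ∘ u) ≈⟨ extendʳ commute ⟨
      q ∘ (p ∘ u) ≈⟨ ∘-resp-≈ʳ pu≈pv ⟩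
      q ∘ (p ∘ v) ≈⟨ extendʳ commute ⟩
      m ∘ (d ∘ v) ∎))

  pushout-comparison-iso : ∀ {A B C Q Q′} {f : C ⇒ A} {g : C ⇒ B}
                           {i₁ : A ⇒ Q} {i₂ : B ⇒ Q} {j₁ : A ⇒ Q′} {j₂ : B ⇒ Q′} →
                           IsPushout f g i₁ i₂ → IsPushout f g j₁ j₂ →
                           (ε : Q ⇒ Q′) → ε ∘ i₁ ≈ j₁ → ε ∘ i₂ ≈ j₂ → IsIso ε
  pushout-comparison-iso {i₁ = i₁} {i₂} {j₁} {j₂} po po′ ε εi₁≈j₁ εi₂≈j₂ =
    θ ,
    Pushout.unique po (θ ∘ ε) id (round-trip εi₁≈j₁ θj₁≈i₁) (round-trip εi₂≈j₂ θj₂≈i₂) ,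
    Pushout.unique po′ (ε ∘ θ) id (round-trip θj₁≈i₁ εi₁≈j₁) (round-trip θj₂≈i₂ εi₂≈j₂)
    where
    θ = Pushout.universal po′ i₁ i₂ (Pushout.commute po)
    θj₁≈i₁ = Pushout.universal∘i₁ po′ i₁ i₂ (Pushout.commute po)
    θj₂≈i₂ = Pushout.universal∘i₂ po′ i₁ i₂ (Pushout.commute po)
    round-trip : ∀ {X Y Z} {u : X ⇒ Y} {v : X ⇒ Z} {s : Y ⇒ Z} {t : Z ⇒ Y} →
                 s ∘ u ≈ v → t ∘ v ≈ u → (t ∘ s) ∘ u ≈ id ∘ u
    round-trip su≈v tv≈u = ≈-trans (pullʳ su≈v) (≈-trans tv≈u (≈-sym identityˡ))

  pullback-comparison-iso : ∀ {A B C P P′} {f : A ⇒ C} {g : B ⇒ C}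
                            {π₁ : P ⇒ A} {π₂ : P ⇒ B} {ρ₁ : P′ ⇒ A} {ρ₂ : P′ ⇒ B} →
                            IsPullback f g π₁ π₂ → IsPullback f g ρ₁ ρ₂ →
                            (δ : P ⇒ P′) → ρ₁ ∘ δ ≈ π₁ → ρ₂ ∘ δ ≈ π₂ → IsIso δ
  pullback-comparison-iso {π₁ = π₁} {π₂} {ρ₁} {ρ₂} pb pb′ δ ρ₁δ≈π₁ ρ₂δ≈π₂ =
    θ ,
    Pullback.unique pb (θ ∘ δ) id (round-trip π₁θ≈ρ₁ ρ₁δ≈π₁) (round-trip π₂θ≈ρ₂ ρ₂δ≈π₂) ,
    Pullback.unique pb′ (δ ∘ θ) id (round-trip ρ₁δ≈π₁ π₁θ≈ρ₁) (round-trip ρ₂δ≈π₂ π₂θ≈ρ₂)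
    where
    θ = Pullback.universal pb ρ₁ ρ₂ (Pullback.commute pb′)
    π₁θ≈ρ₁ = Pullback.π₁∘universal pb ρ₁ ρ₂ (Pullback.commute pb′)
    π₂θ≈ρ₂ = Pullback.π₂∘universal pb ρ₁ ρ₂ (Pullback.commute pb′)
    round-trip : ∀ {X Y Z} {u : X ⇒ Z} {v : Y ⇒ Z} {s : X ⇒ Y} {t : Y ⇒ X} →
                 v ∘ s ≈ u → u ∘ t ≈ v → v ∘ (s ∘ t) ≈ v ∘ id
    round-trip vs≈u ut≈v = ≈-trans (pullˡ vs≈u) (≈-trans ut≈v (≈-sym identityʳ))

  pushout-transport-iso : ∀ {A B C Q Q′} {f : C ⇒ A} {g : C ⇒ B}
                          {i₁ : A ⇒ Q} {i₂ : B ⇒ Q} {j₁ : A ⇒ Q′} {j₂ : B ⇒ Q′} →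
                          IsPushout f g i₁ i₂ → (ε : Q ⇒ Q′) → ε ∘ i₁ ≈ j₁ → ε ∘ i₂ ≈ j₂ →
                          IsIso ε → IsPushout f g j₁ j₂
  pushout-transport-iso {A} {B} {_} {Q} {Q′} {f} {g} {i₁} {i₂} {j₁} {j₂}
                        po ε εi₁≈j₁ εi₂≈j₂ (ε⁻¹ , ε⁻¹ε≈id , εε⁻¹≈id) =
    commute′ , universal′ , unique′
    where
    open Pushout po
    commute′ : j₁ ∘ f ≈ j₂ ∘ g
    commute′ = begin
      j₁ ∘ f       ≈⟨ ∘-resp-≈ˡ εi₁≈j₁ ⟨
      (ε ∘ i₁) ∘ f ≈⟨ pullʳ commute ⟩
      ε ∘ (i₂ ∘ g) ≈⟨ pullˡ εi₂≈j₂ ⟩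
      j₂ ∘ g       ∎
    ε⁻¹-on : ∀ {X W} {i : X ⇒ _} {j : X ⇒ _} (u : Q ⇒ W) → ε ∘ i ≈ j → (u ∘ ε⁻¹) ∘ j ≈ u ∘ i
    ε⁻¹-on {i = i} {j} u εi≈j = begin
      (u ∘ ε⁻¹) ∘ j       ≈⟨ ∘-resp-≈ʳ εi≈j ⟨
      (u ∘ ε⁻¹) ∘ (ε ∘ i) ≈⟨ pullʳ (pullˡ ε⁻¹ε≈id) ⟩
      u ∘ (id ∘ i)        ≈⟨ ∘-resp-≈ʳ identityˡ ⟩
      u ∘ i               ∎
    universal′ : ∀ {W} (x : A ⇒ W) (y : B ⇒ W) → x ∘ f ≈ y ∘ g →
                 Σ (Q′ ⇒ W) λ u → (u ∘ j₁ ≈ x) × (u ∘ j₂ ≈ y)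
    universal′ x y eq =
      universal x y eq ∘ ε⁻¹ ,
      ≈-trans (ε⁻¹-on _ εi₁≈j₁) (universal∘i₁ x y eq) ,
      ≈-trans (ε⁻¹-on _ εi₂≈j₂) (universal∘i₂ x y eq)
    unique′ : ∀ {W} (u v : Q′ ⇒ W) → u ∘ j₁ ≈ v ∘ j₁ → u ∘ j₂ ≈ v ∘ j₂ → u ≈ v
    unique′ u v eq₁ eq₂ = begin
      u             ≈⟨ cancelˡ εε⁻¹≈id ⟨
      (u ∘ ε) ∘ ε⁻¹ ≈⟨ ∘-resp-≈ˡ (unique (u ∘ ε) (v ∘ ε) (along εi₁≈j₁ eq₁) (along εi₂≈j₂ eq₂)) ⟩
      (v ∘ ε) ∘ ε⁻¹ ≈⟨ cancelˡ εε⁻¹≈id ⟩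
      v             ∎
      where
      along : ∀ {X} {i : X ⇒ _} {j : X ⇒ _} → ε ∘ i ≈ j → u ∘ j ≈ v ∘ j → (u ∘ ε) ∘ i ≈ (v ∘ ε) ∘ i
      along εi≈j uj≈vj = ≈-trans (pullʳ εi≈j) (≈-trans uj≈vj (≈-sym (pullʳ εi≈j)))

  pushout-unglue : ∀ {A B C D E P} {f : A ⇒ B} {n : A ⇒ C} {m : B ⇒ E} {q : C ⇒ E}
                   {a : A ⇒ P} {b : B ⇒ D} {d : P ⇒ D} {p : P ⇒ C} {m′ : D ⇒ E} →
                   IsPushout f n m q → IsPushout f a b d →
                   p ∘ a ≈ n → m′ ∘ b ≈ m → q ∘ p ≈ m′ ∘ d → IsPushout p d q m′
  pushout-unglue {f = f} {n} {m} {q} {a} {b} {d} {p} {m′} outer left pa≈n m′b≈m qp≈m′d =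
    qp≈m′d , universal′ , unique′
    where
    module O = Pushout outer
    module L = Pushout left
    universal′ : ∀ {W} (x : _ ⇒ W) (y : _ ⇒ W) → x ∘ p ≈ y ∘ d →
                 Σ (_ ⇒ W) λ u → (u ∘ q ≈ x) × (u ∘ m′ ≈ y)
    universal′ x y xp≈yd = u , uq≈x , L.unique (u ∘ m′) y (≈-trans (pullʳ m′b≈m) um≈yb) (begin
      (u ∘ m′) ∘ d ≈⟨ extendˡ qp≈m′d ⟨
      (u ∘ q) ∘ p  ≈⟨ ∘-resp-≈ˡ uq≈x ⟩
      x ∘ p        ≈⟨ xp≈yd ⟩
      y ∘ d        ∎)
      where
      cocone : (y ∘ b) ∘ f ≈ x ∘ n
      cocone = begin
        (y ∘ b) ∘ f ≈⟨ extendˡ L.commute ⟩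
        (y ∘ d) ∘ a ≈⟨ ∘-resp-≈ˡ xp≈yd ⟨
        (x ∘ p) ∘ a ≈⟨ pullʳ pa≈n ⟩
        x ∘ n       ∎
      u = O.universal (y ∘ b) x cocone
      um≈yb = O.universal∘i₁ (y ∘ b) x cocone
      uq≈x = O.universal∘i₂ (y ∘ b) x cocone
    unique′ : ∀ {W} (u v : _ ⇒ W) → u ∘ q ≈ v ∘ q → u ∘ m′ ≈ v ∘ m′ → u ≈ v
    unique′ u v uq≈vq um′≈vm′ = O.unique u v (begin
      u ∘ m        ≈⟨ pullʳ m′b≈m ⟨
      (u ∘ m′) ∘ b ≈⟨ ∘-resp-≈ˡ um′≈vm′ ⟩
      (v ∘ m′) ∘ b ≈⟨ pullʳ m′b≈m ⟩
      v ∘ m        ∎) uq≈vq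

  pullback-glue : ∀ {A A′ B C P Q} {h : A ⇒ C} {g : B ⇒ C} {π₁ : P ⇒ A} {π₂ : P ⇒ B}
                  {k : A′ ⇒ A} {ρ₁ : Q ⇒ A′} {ρ₂ : Q ⇒ P} →
                  IsPullback h g π₁ π₂ → IsPullback k π₁ ρ₁ ρ₂ → IsPullback (h ∘ k) g ρ₁ (π₂ ∘ ρ₂)
  pullback-glue {h = h} {g} {π₁} {π₂} {k} {ρ₁} {ρ₂} right left =
    commute′ , universal′ , unique′
    where
    module R = Pullback right
    module L = Pullback left
    commute′ : (h ∘ k) ∘ ρ₁ ≈ g ∘ (π₂ ∘ ρ₂)
    commute′ = begin
      (h ∘ k) ∘ ρ₁  ≈⟨ pullʳ L.commute ⟩
      h ∘ (π₁ ∘ ρ₂) ≈⟨ extendʳ R.commute ⟩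
      g ∘ (π₂ ∘ ρ₂) ∎
    universal′ : ∀ {W} (x : W ⇒ _) (y : W ⇒ _) → (h ∘ k) ∘ x ≈ g ∘ y →
                 Σ (W ⇒ _) λ u → (ρ₁ ∘ u ≈ x) × ((π₂ ∘ ρ₂) ∘ u ≈ y)
    universal′ x y eq =
      u , L.π₁∘universal x v (≈-sym π₁v≈kx) ,
      ≈-trans (pullʳ (L.π₂∘universal x v (≈-sym π₁v≈kx))) (R.π₂∘universal (k ∘ x) y hkx≈gy)
      where
      hkx≈gy = ≈-trans sym-assoc eq
      v = R.universal (k ∘ x) y hkx≈gy
      π₁v≈kx = R.π₁∘universal (k ∘ x) y hkx≈gy
      u = L.universal x v (≈-sym π₁v≈kx)
    unique′ : ∀ {W} (u v : W ⇒ _) → ρ₁ ∘ u ≈ ρ₁ ∘ v → (π₂ ∘ ρ₂) ∘ u ≈ (π₂ ∘ ρ₂) ∘ v → u ≈ v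
    unique′ u v ρ₁u≈ρ₁v π₂ρ₂u≈π₂ρ₂v = L.unique u v ρ₁u≈ρ₁v (R.unique (ρ₂ ∘ u) (ρ₂ ∘ v)
      (begin
        π₁ ∘ (ρ₂ ∘ u) ≈⟨ extendʳ L.commute ⟨
        k ∘ (ρ₁ ∘ u)  ≈⟨ ∘-resp-≈ʳ ρ₁u≈ρ₁v ⟩
        k ∘ (ρ₁ ∘ v)  ≈⟨ extendʳ L.commute ⟩
        π₁ ∘ (ρ₂ ∘ v) ∎)
      (≈-trans sym-assoc (≈-trans π₂ρ₂u≈π₂ρ₂v assoc)))

  IsIso-id : ∀ {X} → IsIso (id {X})
  IsIso-id = id , identityˡ , identityˡ

  kernel-pair-cancel : ∀ {A B K X} {f : A ⇒ B} {k₁ k₂ : K ⇒ A} {u v : A ⇒ X} →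
                       IsPullback f f k₁ k₂ → u ∘ k₁ ≈ v ∘ k₂ → u ≈ v
  kernel-pair-cancel {k₁ = k₁} {k₂} {u} {v} kp uk₁≈vk₂ = begin
    u              ≈⟨ identityʳ ⟨
    u ∘ id         ≈⟨ ∘-resp-≈ʳ k₁Δ≈id ⟨
    u ∘ (k₁ ∘ Δ)   ≈⟨ extendʳ uk₁≈vk₂ ⟩
    v ∘ (k₂ ∘ Δ)   ≈⟨ ∘-resp-≈ʳ k₂Δ≈id ⟩
    v ∘ id         ≈⟨ identityʳ ⟩
    v              ∎
    where
    Δ = Pullback.universal kp id id ≈-refl
    k₁Δ≈id = Pullback.π₁∘universal kp id id ≈-refl
    k₂Δ≈id = Pullback.π₂∘universal kp id id ≈-refl

  factor-through-mono-is-pullback : ∀ {V D E} {s : V ⇒ E} {m : D ⇒ E} {w : V ⇒ D} →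
                                    Mono m → m ∘ w ≈ s → IsPullback s m id w
  factor-through-mono-is-pullback {w = w} m-mono mw≈s =
    ≈-trans identityʳ (≈-sym mw≈s) ,
    (λ x y sx≈my → x , identityˡ , m-mono (w ∘ x) y (≈-trans (pullˡ mw≈s) sx≈my)) ,
    (λ u v id∘u≈id∘v _ → ≈-trans (≈-sym identityˡ) (≈-trans id∘u≈id∘v identityˡ))

  id-pullback : ∀ {D E} {m : D ⇒ E} → IsPullback id m m id
  id-pullback =
    ≈-trans identityˡ (≈-sym identityʳ) ,
    (λ x y id∘x≈my → y , ≈-trans (≈-sym id∘x≈my) identityˡ , identityˡ) ,
    (λ u v _ id∘u≈id∘v → ≈-trans (≈-sym identityˡ) (≈-trans id∘u≈id∘v identityˡ))

  module Terminal {T : Obj} (isT : IsTerminal T) where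
    ! : ∀ {X} → X ⇒ T
    ! {X} = proj₁ (isT X)

    !-unique₂ : ∀ {X} (u v : X ⇒ T) → u ≈ v
    !-unique₂ {X} u v = ≈-trans (proj₂ (isT X) u) (≈-sym (proj₂ (isT X) v))

  module BinaryProduct (fl : HasFiniteLimits) (X Y : Obj) where
    open Terminal (proj₂ (proj₁ fl))

    product = proj₂ fl (! {X}) (! {Y})
    X×Y = proj₁ product
    π₁ : X×Y ⇒ X
    π₁ = proj₁ (proj₂ product)
    π₂ : X×Y ⇒ Y
    π₂ = proj₁ (proj₂ (proj₂ product))
    product-pullback = proj₂ (proj₂ (proj₂ product))

    ⟨_,_⟩ : ∀ {V} → V ⇒ X → V ⇒ Y → V ⇒ X×Y
    ⟨ g , h ⟩ = Pullback.universal product-pullback g h (!-unique₂ _ _)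

    π₁∘⟨⟩ : ∀ {V} {g : V ⇒ X} {h : V ⇒ Y} → π₁ ∘ ⟨ g , h ⟩ ≈ g
    π₁∘⟨⟩ {g = g} {h} = Pullback.π₁∘universal product-pullback g h (!-unique₂ _ _)

    π₂∘⟨⟩ : ∀ {V} {g : V ⇒ X} {h : V ⇒ Y} → π₂ ∘ ⟨ g , h ⟩ ≈ h
    π₂∘⟨⟩ {g = g} {h} = Pullback.π₂∘universal product-pullback g h (!-unique₂ _ _)

    ⟨⟩-unique : ∀ {V} {g : V ⇒ X} {h : V ⇒ Y} (k : V ⇒ X×Y) → π₁ ∘ k ≈ g → π₂ ∘ k ≈ h → k ≈ ⟨ g , h ⟩
    ⟨⟩-unique k π₁k≈g π₂k≈h =
      Pullback.unique product-pullback k _ (≈-trans π₁k≈g (≈-sym π₁∘⟨⟩)) (≈-trans π₂k≈h (≈-sym π₂∘⟨⟩))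

    ⟨⟩-cong : ∀ {V} {g g′ : V ⇒ X} {h h′ : V ⇒ Y} → g ≈ g′ → h ≈ h′ → ⟨ g , h ⟩ ≈ ⟨ g′ , h′ ⟩
    ⟨⟩-cong g≈g′ h≈h′ = ⟨⟩-unique _ (≈-trans π₁∘⟨⟩ g≈g′) (≈-trans π₂∘⟨⟩ h≈h′)

    ⟨⟩∘ : ∀ {U V} {g : V ⇒ X} {h : V ⇒ Y} {k : U ⇒ V} → ⟨ g , h ⟩ ∘ k ≈ ⟨ g ∘ k , h ∘ k ⟩
    ⟨⟩∘ = ⟨⟩-unique _ (pullˡ π₁∘⟨⟩) (pullˡ π₂∘⟨⟩)

  record Exponential {X Y Z} (p : Y ⇒ X) (q : Z ⇒ X) : Set (o ⊔ ℓ ⊔ e) where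
    field
      {Exp Exp×Y} : Obj
      r : Exp ⇒ X
      e₁ : Exp×Y ⇒ Exp
      e₂ : Exp×Y ⇒ Y
      e-pullback : IsPullback r p e₁ e₂
      ev : Exp×Y ⇒ Z
      ev-over : q ∘ ev ≈ p ∘ e₂

    Evaluates : ∀ {W WY} → W ⇒ Exp → WY ⇒ W → WY ⇒ Y → WY ⇒ Z → Set (ℓ ⊔ e)
    Evaluates k w₁ w₂ h = ∀ u → e₁ ∘ u ≈ k ∘ w₁ → e₂ ∘ u ≈ w₂ → ev ∘ u ≈ h

    field
      curry : ∀ {W WY} (s : W ⇒ X) (w₁ : WY ⇒ W) (w₂ : WY ⇒ Y) → IsPullback s p w₁ w₂ →
              (h : WY ⇒ Z) → q ∘ h ≈ p ∘ w₂ →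
              Σ (W ⇒ Exp) λ k → (r ∘ k ≈ s) × Evaluates k w₁ w₂ h ×
                (∀ k′ → r ∘ k′ ≈ s → Evaluates k′ w₁ w₂ h → k′ ≈ k)

    evaluates-intro : ∀ {W WY} {k : W ⇒ Exp} {w₁ : WY ⇒ W} {w₂ : WY ⇒ Y} {h : WY ⇒ Z}
                      (σ : WY ⇒ Exp×Y) → e₁ ∘ σ ≈ k ∘ w₁ → e₂ ∘ σ ≈ w₂ → ev ∘ σ ≈ h →
                      Evaluates k w₁ w₂ h
    evaluates-intro σ e₁σ≈kw₁ e₂σ≈w₂ evσ≈h u e₁u≈kw₁ e₂u≈w₂ = ≈-trans
      (∘-resp-≈ʳ (Pullback.unique e-pullback u σ (≈-trans e₁u≈kw₁ (≈-sym e₁σ≈kw₁))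
                                                 (≈-trans e₂u≈w₂ (≈-sym e₂σ≈w₂))))
      evσ≈h

    evaluates-∘ : ∀ {W WY V VY} {k : W ⇒ Exp} {w₁ : WY ⇒ W} {w₂ : WY ⇒ Y} {h : WY ⇒ Z}
                  {g : V ⇒ W} {g′ : VY ⇒ WY} {v₁ : VY ⇒ V} {v₂ : VY ⇒ Y} {h′ : VY ⇒ Z} →
                  r ∘ (k ∘ w₁) ≈ p ∘ w₂ → Evaluates k w₁ w₂ h →
                  w₁ ∘ g′ ≈ g ∘ v₁ → w₂ ∘ g′ ≈ v₂ → h ∘ g′ ≈ h′ → Evaluates (k ∘ g) v₁ v₂ h′
    evaluates-∘ {k = k} {w₁} {w₂} {g = g} {g′} {v₁} over eval w₁g′≈gv₁ w₂g′≈v₂ hg′≈h′ =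
      evaluates-intro (σ ∘ g′)
        (begin
          e₁ ∘ (σ ∘ g′)  ≈⟨ pullˡ e₁σ≈kw₁ ⟩
          (k ∘ w₁) ∘ g′  ≈⟨ pullʳ w₁g′≈gv₁ ⟩
          k ∘ (g ∘ v₁)   ≈⟨ sym-assoc ⟩
          (k ∘ g) ∘ v₁   ∎)
        (≈-trans (pullˡ e₂σ≈w₂) w₂g′≈v₂)
        (≈-trans (pullˡ (eval σ e₁σ≈kw₁ e₂σ≈w₂)) hg′≈h′)
      where
      σ = Pullback.universal e-pullback (k ∘ w₁) w₂ over
      e₁σ≈kw₁ = Pullback.π₁∘universal e-pullback (k ∘ w₁) w₂ over
      e₂σ≈w₂ = Pullback.π₂∘universal e-pullback (k ∘ w₁) w₂ over

  exponential : ∀ {X Y Z} {p : Y ⇒ X} {q : Z ⇒ X} → SliceExponential p q → Exponential p q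
  exponential (_ , r , _ , e₁ , e₂ , e-pullback , ev , ev-over , curry) = record
    { r = r ; e₁ = e₁ ; e₂ = e₂ ; e-pullback = e-pullback ; ev = ev ; ev-over = ev-over ; curry = curry }

  record RegularPartialMapClassifier (B : Obj) : Set (o ⊔ ℓ ⊔ e) where
    field
      {B̃} : Obj
      η : B ⇒ B̃
      classify : ∀ {A P} (a : A ⇒ P) → RegularMono a → A ⇒ B → P ⇒ B̃
      classify-pullback : ∀ {A P} (a : A ⇒ P) (ra : RegularMono a) (f : A ⇒ B) →
                          IsPullback η (classify a ra f) f a

  regular-partial-map-classifier : RegularSubobjectClassifier → LocallyCartesianClosed →
                                   ∀ B → RegularPartialMapClassifier B
  regular-partial-map-classifier (T , isT , Ω , true , _ , characteristic) lcc B = record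
    { η = η ; classify = φ ; classify-pullback = pullback }
    where
    open Terminal isT
    -- B̃ is (true ∘ !)^true in 𝒞/Ω: maps into it over χ are maps into B from the subobject χ classifies.
    open Exponential (exponential (lcc true (true ∘ ! {B})))

    over-true : ∀ {W} (h : W ⇒ B) (w : W ⇒ T) → (true ∘ !) ∘ h ≈ true ∘ w
    over-true h w = ≈-trans assoc (∘-resp-≈ʳ (!-unique₂ _ _))

    trivial-pullback : ∀ {W} → IsPullback (true ∘ ! {W}) true id !
    trivial-pullback = factor-through-mono-is-pullback (λ u v _ → !-unique₂ u v) ≈-refl

    total = curry (true ∘ !) id ! trivial-pullback id (over-true id !)
    η = proj₁ total
    rη≈true! = proj₁ (proj₂ total)
    η-evaluates = proj₁ (proj₂ (proj₂ total))

    module _ {A P} (a : A ⇒ P) (ra : RegularMono a) (f : A ⇒ B) where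
      χ = proj₁ (characteristic a ra)
      χ-pullback = proj₁ (proj₂ (characteristic a ra))
      partial = curry χ a ! χ-pullback f (over-true f !)
      φ = proj₁ partial
      rφ≈χ = proj₁ (proj₂ partial)
      φ-evaluates = proj₁ (proj₂ (proj₂ partial))

    η-mono : Mono η
    η-mono g g′ ηg≈ηg′ = begin
      g              ≈⟨ ev-σ g ⟨
      ev ∘ (σ ∘ g)   ≈⟨ ∘-resp-≈ʳ (Pullback.unique e-pullback (σ ∘ g) (σ ∘ g′) e₁-agree (!-unique₂ _ _)) ⟩
      ev ∘ (σ ∘ g′)  ≈⟨ ev-σ g′ ⟩
      g′             ∎
      where
      over = ≈-trans (pullˡ rη≈true!) identityʳ
      σ = Pullback.universal e-pullback (η ∘ id) ! over
      e₁σ≈η = ≈-trans (Pullback.π₁∘universal e-pullback (η ∘ id) ! over) identityʳ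
      ev-σ : ∀ {W} (h : W ⇒ B) → ev ∘ (σ ∘ h) ≈ h
      ev-σ h = ≈-trans (pullˡ (η-evaluates σ (≈-trans e₁σ≈η (≈-sym identityʳ))
                                             (Pullback.π₂∘universal e-pullback (η ∘ id) ! over)))
                       identityˡ
      e₁-agree = ≈-trans (pullˡ e₁σ≈η) (≈-trans ηg≈ηg′ (≈-sym (pullˡ e₁σ≈η)))

    η∘f≈φ∘a : ∀ {A P} (a : A ⇒ P) (ra : RegularMono a) (f : A ⇒ B) → η ∘ f ≈ φ a ra f ∘ a
    η∘f≈φ∘a {A} a ra f =
      ≈-trans (k-unique (η ∘ f) (≈-trans (pullˡ rη≈true!) (over-true f !)) η∘f-evaluates)
              (≈-sym (k-unique (φ a ra f ∘ a) φ∘a-over φ∘a-evaluates))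
      where
      A-partial = curry (true ∘ !) id ! (trivial-pullback {A}) f (over-true f !)
      k-unique = proj₂ (proj₂ (proj₂ A-partial))
      η∘f-evaluates : Evaluates (η ∘ f) id ! f
      η∘f-evaluates = evaluates-∘ (≈-trans (pullˡ rη≈true!) (over-true id !)) η-evaluates
                                  (≈-trans identityˡ (≈-sym identityʳ)) (!-unique₂ _ _) identityˡ
      φ∘a-over = ≈-trans (pullˡ (rφ≈χ a ra f)) (Pullback.commute (χ-pullback a ra f))
      φ∘a-evaluates : Evaluates (φ a ra f ∘ a) id ! f
      φ∘a-evaluates = evaluates-∘ φ∘a-over (φ-evaluates a ra f) ≈-refl identityʳ identityʳ

    pullback : ∀ {A P} (a : A ⇒ P) (ra : RegularMono a) (f : A ⇒ B) → IsPullback η (φ a ra f) f a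
    pullback a ra f = η∘f≈φ∘a a ra f , universal′ , λ u v _ → RegularMono⇒Mono ra u v
      where
      universal′ : ∀ {W} (x : W ⇒ B) (y : W ⇒ _) → η ∘ x ≈ φ a ra f ∘ y →
                   Σ (W ⇒ _) λ z → (f ∘ z ≈ x) × (a ∘ z ≈ y)
      universal′ x y ηx≈φy = z , η-mono (f ∘ z) x ηfz≈ηx , az≈y
        where
        χy≈true! : χ a ra f ∘ y ≈ true ∘ !
        χy≈true! = begin
          χ a ra f ∘ y       ≈⟨ ∘-resp-≈ˡ (rφ≈χ a ra f) ⟨
          (r ∘ φ a ra f) ∘ y ≈⟨ assoc ⟩
          r ∘ (φ a ra f ∘ y) ≈⟨ pullʳ ηx≈φy ⟨
          (r ∘ η) ∘ x        ≈⟨ ∘-resp-≈ˡ rη≈true! ⟩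
          (true ∘ !) ∘ x     ≈⟨ over-true x ! ⟩
          true ∘ !           ∎
        z = Pullback.universal (χ-pullback a ra f) y ! χy≈true!
        az≈y = Pullback.π₁∘universal (χ-pullback a ra f) y ! χy≈true!
        ηfz≈ηx = begin
          η ∘ (f ∘ z)          ≈⟨ extendʳ (η∘f≈φ∘a a ra f) ⟩
          φ a ra f ∘ (a ∘ z)   ≈⟨ ∘-resp-≈ʳ az≈y ⟩
          φ a ra f ∘ y         ≈⟨ ηx≈φy ⟨
          η ∘ x                ∎

  pushout-along-RegularMono-is-pullback :
    ∀ {A B P D} {f : A ⇒ B} {a : A ⇒ P} {i : B ⇒ D} {j : P ⇒ D} →
    RegularPartialMapClassifier B → RegularMono a → IsPushout f a i j → IsPullback i j f a
  pushout-along-RegularMono-is-pullback {f = f} {a} {i} {j} classifier ra po =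
    commute , universal′ , λ u v _ → RegularMono⇒Mono ra u v
    where
    open Pushout po
    open RegularPartialMapClassifier classifier
    φ-pullback = classify-pullback a ra f
    U = universal η (classify a ra f) (Pullback.commute φ-pullback)
    Ui≈η = universal∘i₁ η (classify a ra f) (Pullback.commute φ-pullback)
    Uj≈φ = universal∘i₂ η (classify a ra f) (Pullback.commute φ-pullback)
    universal′ : ∀ {W} (x : W ⇒ _) (y : W ⇒ _) → i ∘ x ≈ j ∘ y →
                 Σ (W ⇒ _) λ z → (f ∘ z ≈ x) × (a ∘ z ≈ y)
    universal′ x y ix≈jy =
      Pullback.universal φ-pullback x y ηx≈φy ,
      Pullback.π₁∘universal φ-pullback x y ηx≈φy ,
      Pullback.π₂∘universal φ-pullback x y ηx≈φy
      where
      ηx≈φy = begin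
        η ∘ x                ≈⟨ ∘-resp-≈ˡ Ui≈η ⟨
        (U ∘ i) ∘ x          ≈⟨ pullʳ ix≈jy ⟩
        U ∘ (j ∘ y)          ≈⟨ pullˡ Uj≈φ ⟩
        classify a ra f ∘ y  ∎

  module DependentProduct (fl : HasFiniteLimits) (lcc : LocallyCartesianClosed)
                          {D E : Obj} {m : D ⇒ E} (m-mono : Mono m) (W : Obj) where
    open BinaryProduct fl W D
    -- Exp is Π_m (W × D → D): maps into it over s are maps into W from the pullback of s along m.
    open Exponential (exponential (lcc m (m ∘ π₂)))

    module _ {V V′} {s : V ⇒ E} {w₁ : V′ ⇒ V} {w₂ : V′ ⇒ D} (pb : IsPullback s m w₁ w₂) where
      private
        transposition = λ (h : V′ ⇒ W) → curry s w₁ w₂ pb ⟨ h , w₂ ⟩ (pullʳ π₂∘⟨⟩)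

      transpose : V′ ⇒ W → V ⇒ Exp
      transpose h = proj₁ (transposition h)

      r∘transpose : ∀ h → r ∘ transpose h ≈ s
      r∘transpose h = proj₁ (proj₂ (transposition h))

      transpose-evaluates : ∀ h → Evaluates (transpose h) w₁ w₂ ⟨ h , w₂ ⟩
      transpose-evaluates h = proj₁ (proj₂ (proj₂ (transposition h)))

      transpose-unique : ∀ h k → r ∘ k ≈ s → Evaluates k w₁ w₂ ⟨ h , w₂ ⟩ → k ≈ transpose h
      transpose-unique h = proj₂ (proj₂ (proj₂ (transposition h)))

      restricts : ∀ {k} → r ∘ k ≈ s → r ∘ (k ∘ w₁) ≈ m ∘ w₂
      restricts rk≈s = ≈-trans (pullˡ rk≈s) (Pullback.commute pb)

      module _ (k : V ⇒ Exp) (rk≈s : r ∘ k ≈ s) where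
        lift : V′ ⇒ Exp×Y
        lift = Pullback.universal e-pullback (k ∘ w₁) w₂ (restricts rk≈s)

        e₁∘lift : e₁ ∘ lift ≈ k ∘ w₁
        e₁∘lift = Pullback.π₁∘universal e-pullback (k ∘ w₁) w₂ (restricts rk≈s)

        e₂∘lift : e₂ ∘ lift ≈ w₂
        e₂∘lift = Pullback.π₂∘universal e-pullback (k ∘ w₁) w₂ (restricts rk≈s)

        untranspose : V′ ⇒ W
        untranspose = π₁ ∘ (ev ∘ lift)

        transpose-untranspose : k ≈ transpose untranspose
        transpose-untranspose = transpose-unique untranspose k rk≈s
          (evaluates-intro lift e₁∘lift e₂∘lift (⟨⟩-unique (ev ∘ lift) ≈-refl (m-mono _ _ (begin
            m ∘ (π₂ ∘ (ev ∘ lift)) ≈⟨ sym-assoc ⟩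
            (m ∘ π₂) ∘ (ev ∘ lift) ≈⟨ pullˡ ev-over ⟩
            (m ∘ e₂) ∘ lift        ≈⟨ pullʳ e₂∘lift ⟩
            m ∘ w₂                 ∎))))

      untranspose-cong : ∀ {k k′} (rk≈s : r ∘ k ≈ s) (rk′≈s : r ∘ k′ ≈ s) →
                         k ≈ k′ → untranspose k rk≈s ≈ untranspose k′ rk′≈s
      untranspose-cong {k} {k′} rk≈s rk′≈s k≈k′ = ∘-resp-≈ʳ (∘-resp-≈ʳ
        (Pullback.unique e-pullback (lift k rk≈s) (lift k′ rk′≈s)
          (≈-trans (e₁∘lift k rk≈s) (≈-trans (∘-resp-≈ˡ k≈k′) (≈-sym (e₁∘lift k′ rk′≈s))))
          (≈-trans (e₂∘lift k rk≈s) (≈-sym (e₂∘lift k′ rk′≈s)))))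

      untranspose-transpose : ∀ h → untranspose (transpose h) (r∘transpose h) ≈ h
      untranspose-transpose h = begin
        π₁ ∘ (ev ∘ lift (transpose h) (r∘transpose h)) ≈⟨ ∘-resp-≈ʳ (transpose-evaluates h _
                                                            (e₁∘lift (transpose h) (r∘transpose h))
                                                            (e₂∘lift (transpose h) (r∘transpose h))) ⟩
        π₁ ∘ ⟨ h , w₂ ⟩                                ≈⟨ π₁∘⟨⟩ ⟩
        h                                              ∎

      transpose-injective : ∀ {h h′} → transpose h ≈ transpose h′ → h ≈ h′
      transpose-injective {h} {h′} th≈th′ = begin
        h                                               ≈⟨ untranspose-transpose h ⟨
        untranspose (transpose h) (r∘transpose h)       ≈⟨ untranspose-cong _ _ th≈th′ ⟩
        untranspose (transpose h′) (r∘transpose h′)     ≈⟨ untranspose-transpose h′ ⟩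
        h′                                              ∎

    transpose-natural :
      ∀ {V V′ U U′} {s : V ⇒ E} {w₁ : V′ ⇒ V} {w₂ : V′ ⇒ D} {t : U ⇒ E} {v₁ : U′ ⇒ U} {v₂ : U′ ⇒ D}
      (pb : IsPullback s m w₁ w₂) (pb′ : IsPullback t m v₁ v₂) {g : U ⇒ V} {g′ : U′ ⇒ V′}
      {h : V′ ⇒ W} {h′ : U′ ⇒ W} →
      s ∘ g ≈ t → w₁ ∘ g′ ≈ g ∘ v₁ → w₂ ∘ g′ ≈ v₂ → h ∘ g′ ≈ h′ →
      transpose pb h ∘ g ≈ transpose pb′ h′
    transpose-natural pb pb′ {h = h} sg≈t w₁g′≈gv₁ w₂g′≈v₂ hg′≈h′ =
      transpose-unique pb′ _ _ (≈-trans (pullˡ (r∘transpose pb h)) sg≈t)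
        (evaluates-∘ (restricts pb (r∘transpose pb h)) (transpose-evaluates pb h) w₁g′≈gv₁ w₂g′≈v₂
          (≈-trans ⟨⟩∘ (⟨⟩-cong hg′≈h′ w₂g′≈v₂)))

  pushout-restricts-along-mono :
    ∀ {A B C D E P} {f : A ⇒ B} {n : A ⇒ C} {m : B ⇒ E} {q : C ⇒ E}
    {m′ : D ⇒ E} {b : B ⇒ D} {p : P ⇒ C} {d : P ⇒ D} {a : A ⇒ P} →
    HasFiniteLimits → LocallyCartesianClosed → IsPushout f n m q →
    Mono m′ → m′ ∘ b ≈ m → IsPullback q m′ p d → p ∘ a ≈ n → d ∘ a ≈ b ∘ f →
    IsPushout f a b d
  pushout-restricts-along-mono {f = f} {n} {m} {q} {m′} {b} {p} {d} {a}
                               fl lcc po m′-mono m′b≈m pb pa≈n da≈bf =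
    ≈-sym da≈bf , universal′ , unique′
    where
    module PO = Pushout po
    B-pullback : IsPullback m m′ id b
    B-pullback = factor-through-mono-is-pullback m′-mono m′b≈m
    A-pullback : IsPullback (m ∘ f) m′ id (b ∘ f)
    A-pullback = factor-through-mono-is-pullback m′-mono (pullˡ m′b≈m)
    qp≈m′d = Pullback.commute pb
    module Π W = DependentProduct fl lcc m′-mono W

    restrict-to-B : ∀ {W} {z : _ ⇒ W} {h} → z ∘ b ≈ h →
                    Π.transpose W id-pullback z ∘ m ≈ Π.transpose W B-pullback h
    restrict-to-B = Π.transpose-natural _ id-pullback B-pullback identityˡ
                                      (≈-trans m′b≈m (≈-sym identityʳ)) identityˡ
    restrict-to-P : ∀ {W} {z : _ ⇒ W} {h} → z ∘ d ≈ h →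
                    Π.transpose W id-pullback z ∘ q ≈ Π.transpose W pb h
    restrict-to-P = Π.transpose-natural _ id-pullback pb identityˡ (≈-sym qp≈m′d) identityˡ

    universal′ : ∀ {W} (x : _ ⇒ W) (y : _ ⇒ W) → x ∘ f ≈ y ∘ a →
                 Σ (_ ⇒ W) λ z → (z ∘ b ≈ x) × (z ∘ d ≈ y)
    universal′ {W} x y xf≈ya = z , zb≈x , zd≈y
      where
      open Π W
      compatible : transpose B-pullback x ∘ f ≈ transpose pb y ∘ n
      compatible = ≈-trans
        (transpose-natural B-pullback A-pullback ≈-refl (≈-trans identityˡ (≈-sym identityʳ)) ≈-refl ≈-refl)
        (≈-sym (transpose-natural pb A-pullback (≈-sym PO.commute) (≈-trans pa≈n (≈-sym identityʳ)) da≈bf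
                                  (≈-sym xf≈ya)))
      κ = PO.universal (transpose B-pullback x) (transpose pb y) compatible
      κm≈ = PO.universal∘i₁ (transpose B-pullback x) (transpose pb y) compatible
      κq≈ = PO.universal∘i₂ (transpose B-pullback x) (transpose pb y) compatible
      rκ≈id = PO.unique _ id (≈-trans (pullʳ κm≈) (≈-trans (r∘transpose B-pullback x) (≈-sym identityˡ)))
                             (≈-trans (pullʳ κq≈) (≈-trans (r∘transpose pb y) (≈-sym identityˡ)))
      z = untranspose id-pullback κ rκ≈id
      κ≈ = transpose-untranspose id-pullback κ rκ≈id
      zb≈x = transpose-injective B-pullback (begin
        transpose B-pullback (z ∘ b)   ≈⟨ restrict-to-B ≈-refl ⟨
        transpose id-pullback z ∘ m    ≈⟨ ∘-resp-≈ˡ κ≈ ⟨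
        κ ∘ m                          ≈⟨ κm≈ ⟩
        transpose B-pullback x         ∎)
      zd≈y = transpose-injective pb (begin
        transpose pb (z ∘ d)           ≈⟨ restrict-to-P ≈-refl ⟨
        transpose id-pullback z ∘ q    ≈⟨ ∘-resp-≈ˡ κ≈ ⟨
        κ ∘ q                          ≈⟨ κq≈ ⟩
        transpose pb y                 ∎)

    unique′ : ∀ {W} (u v : _ ⇒ W) → u ∘ b ≈ v ∘ b → u ∘ d ≈ v ∘ d → u ≈ v
    unique′ {W} u v ub≈vb ud≈vd = Π.transpose-injective W id-pullback (PO.unique _ _
      (≈-trans (restrict-to-B ≈-refl) (≈-sym (restrict-to-B (≈-sym ub≈vb))))
      (≈-trans (restrict-to-P ≈-refl) (≈-sym (restrict-to-P (≈-sym ud≈vd)))))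

  mPOC-universal-property :
    HasFiniteLimits → LocallyCartesianClosed → RegularSubobjectClassifier →
    ∀ {A B D} (f : A ⇒ B) (b : B ⇒ D) →
    ∀ {C E} (n : A ⇒ C) (m : B ⇒ E) (q : C ⇒ E) → RegularMono n → IsPushout f n m q →
       (m′ : D ⇒ E) → RegularMono m′ → m ≈ m′ ∘ b →
       Σ Obj λ P → Σ (A ⇒ P) λ a → Σ (P ⇒ D) λ d → Σ (P ⇒ C) λ p →
         InMPOC f b a d × RegularMono p × (p ∘ a ≈ n) × (q ∘ p ≈ m′ ∘ d) × IsPushout p d q m′ ×
         (∀ {P′} (a′ : A ⇒ P′) (d′ : P′ ⇒ D) (p′ : P′ ⇒ C) → InMPOC f b a′ d′ →
            RegularMono p′ → p′ ∘ a′ ≈ n → q ∘ p′ ≈ m′ ∘ d′ → IsPushout p′ d′ q m′ →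
            Σ (P ⇒ P′) λ δ → IsIso δ × (δ ∘ a ≈ a′) × (d′ ∘ δ ≈ d))
  mPOC-universal-property fl lcc rsc {A} {_} {D} f b {C} n m q rn po m′ rm′ m≈m′b =
    P , a , d , p , (ra , left) , rp , pa≈n , qp≈m′d , right , unique-up-to-iso
    where
    P = proj₁ (proj₂ fl q m′)
    p : P ⇒ C
    p = proj₁ (proj₂ (proj₂ fl q m′))
    d : P ⇒ D
    d = proj₁ (proj₂ (proj₂ (proj₂ fl q m′)))
    pb : IsPullback q m′ p d
    pb = proj₂ (proj₂ (proj₂ (proj₂ fl q m′)))
    qp≈m′d = Pullback.commute pb
    qn≈m′bf = ≈-trans (≈-sym (Pushout.commute po)) (≈-trans (∘-resp-≈ˡ m≈m′b) assoc)
    a = Pullback.universal pb n (b ∘ f) qn≈m′bf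
    pa≈n = Pullback.π₁∘universal pb n (b ∘ f) qn≈m′bf
    rp = RegularMono-pullback rm′ pb
    ra = RegularMono-cancelˡ rn (RegularMono⇒Mono rp) pa≈n
    left = pushout-restricts-along-mono fl lcc po (RegularMono⇒Mono rm′) (≈-sym m≈m′b) pb pa≈n
                                        (Pullback.π₂∘universal pb n (b ∘ f) qn≈m′bf)
    right = pushout-unglue po left pa≈n (≈-sym m≈m′b) qp≈m′d
    unique-up-to-iso : ∀ {P′} (a′ : A ⇒ P′) (d′ : P′ ⇒ D) (p′ : P′ ⇒ C) → InMPOC f b a′ d′ →
                       RegularMono p′ → p′ ∘ a′ ≈ n → q ∘ p′ ≈ m′ ∘ d′ → IsPushout p′ d′ q m′ →
                       Σ (P ⇒ P′) λ δ → IsIso δ × (δ ∘ a ≈ a′) × (d′ ∘ δ ≈ d)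
    unique-up-to-iso a′ d′ p′ _ rp′ p′a′≈n _ right′ =
      δ , pullback-comparison-iso pb pb′ δ p′δ≈p d′δ≈d ,
      RegularMono⇒Mono rp′ _ _ (≈-trans (pullˡ p′δ≈p) (≈-trans pa≈n (≈-sym p′a′≈n))) , d′δ≈d
      where
      pb′ = pullback-swap (pushout-along-RegularMono-is-pullback
              (regular-partial-map-classifier rsc lcc _) rp′ (pushout-swap right′))
      δ = Pullback.universal pb′ p d qp≈m′d
      p′δ≈p = Pullback.π₁∘universal pb′ p d qp≈m′d
      d′δ≈d = Pullback.π₂∘universal pb′ p d qp≈m′d

  FPC-factors-pullback : ∀ {A B D F P} {f : A ⇒ B} {b : B ⇒ D} {n : A ⇒ F} {g : F ⇒ D}
                         {a : A ⇒ P} {d : P ⇒ D} →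
                         HasFiniteLimits → IsFPC f b n g → IsPullback b d f a →
                         Σ (P ⇒ F) λ w → (g ∘ w ≈ d) × (w ∘ a ≈ n)
  FPC-factors-pullback {f = f} {n = n} {a = a} {d} fl (_ , final) pb = w , gw≈d , wa≈n
    where
    -- Pasting the kernel pair of f onto pb gives a pullback of b ∘ f and d, which finality factors.
    kernel = proj₂ fl f f
    k₁ = proj₁ (proj₂ kernel)
    k₂ = proj₁ (proj₂ (proj₂ kernel))
    kernel-pair = proj₂ (proj₂ (proj₂ kernel))
    factorisation = final k₁ (a ∘ k₂) d (pullback-glue pb kernel-pair)
    w = proj₁ factorisation
    gw≈d = proj₁ (proj₂ factorisation)
    wak₂≈nk₁ = proj₁ (proj₂ (proj₂ factorisation))
    wa≈n = ≈-sym (kernel-pair-cancel kernel-pair (≈-sym (≈-trans assoc wak₂≈nk₁)))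

proposition2 : ∀ {o ℓ e} (𝒞 : Category o ℓ e) →
    let open Category 𝒞 in let open Notions 𝒞 in
    IsQuasiTopos →
    ∀ {A B D} (f : A ⇒ B) (b : B ⇒ D) → RegularMono b →
    -- (i) universal property
    (∀ {C E} (n : A ⇒ C) (m : B ⇒ E) (q : C ⇒ E) → RegularMono n → IsPushout f n m q →
       (m' : D ⇒ E) → RegularMono m' → m ≈ m' ∘ b →
       Σ Obj λ P → Σ (A ⇒ P) λ a → Σ (P ⇒ D) λ d → Σ (P ⇒ C) λ p →
         InMPOC f b a d × RegularMono p × (p ∘ a ≈ n) × (q ∘ p ≈ m' ∘ d) × IsPushout p d q m' ×
         (∀ {P'} (a' : A ⇒ P') (d' : P' ⇒ D) (p' : P' ⇒ C) → InMPOC f b a' d' →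
            RegularMono p' → p' ∘ a' ≈ n → q ∘ p' ≈ m' ∘ d' → IsPushout p' d' q m' →
            Σ (P ⇒ P') λ δ → IsIso δ × (δ ∘ a ≈ a') × (d' ∘ δ ≈ d)))
    ×
    -- (ii) computation via the final pullback complement
    (∀ {F} (n : A ⇒ F) (g : F ⇒ D) → IsFPC f b n g →
       (∀ {P D'} (a : A ⇒ P) (p : P ⇒ F) → RegularMono a → p ∘ a ≈ n →
          (i : B ⇒ D') (j : P ⇒ D') → IsPushout f a i j →
          (ε : D' ⇒ D) → ε ∘ i ≈ b → ε ∘ j ≈ g ∘ p → IsIso ε →
          InMPOC f b a (g ∘ p))
       ×
       (∀ {P} (a : A ⇒ P) (d : P ⇒ D) → InMPOC f b a d →
          Σ Obj λ P' → Σ (A ⇒ P') λ a' → Σ (P' ⇒ F) λ p' →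
            RegularMono a' × (p' ∘ a' ≈ n) ×
            (∀ {D'} (i : B ⇒ D') (j : P' ⇒ D') → IsPushout f a' i j →
               (ε : D' ⇒ D) → ε ∘ i ≈ b → ε ∘ j ≈ g ∘ p' → IsIso ε) ×
            Σ (P' ⇒ P) λ δ → IsIso δ × (δ ∘ a' ≈ a) × (d ∘ δ ≈ g ∘ p')))
proposition2 𝒞 (fl , _ , lcc , rsc) f b _ =
  mPOC-universal-property fl lcc rsc f b ,
  λ n g fpc →
    (λ a p ra _ i j po ε εi≈b εj≈gp ε-iso → ra , pushout-transport-iso po ε εi≈b εj≈gp ε-iso) ,
    (λ {P} a d (ra , po) →
      let pb = pushout-along-RegularMono-is-pullback (regular-partial-map-classifier rsc lcc _) ra po
          (w , gw≈d , wa≈n) = FPC-factors-pullback fl fpc pb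
      in P , a , w , ra , wa≈n ,
         (λ i j po′ ε εi≈b εj≈gw → pushout-comparison-iso po′ po ε εi≈b (≈-trans εj≈gw gw≈d)) ,
         id , IsIso-id , identityˡ , ≈-trans identityʳ (≈-sym gw≈d))
  where
  open Category 𝒞
  open HomReasoning 𝒞
  open Properties 𝒞
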